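{- (1) The trace preorder $\sqsubseteq_T$ is axiomatized by $\{B_1\text{ -- }B_4,(S),(ND^F)\}$. (2) The completed trace preorder $\sqsubseteq_{CT}$ is axiomatized by $\{B_1\text{ -- }B_4,(CS),(ND^F)\}$.
   Context: BCCSP processes over a set $\mathit{Act}$: $p ::= \mathbf{0}\mid ap\mid p+q$; transitions $ap\xrightarrow{a}p$, and $p\xrightarrow{a}p'$ implies $p+q\xrightarrow{a}p'$ and $q+p\xrightarrow{a}p'$; $p\overset{\alpha}{\Rightarrow}q$ for a sequence of transitions labelled $\alpha$. $I(p)=\{a\mid\exists p'.\,p\xrightarrow{a}p'\}$. Traces $T(p)=\{\alpha\mid\exists p'.\,p\overset{\alpha}{\Rightarrow}p'\}$; completed traces $CT(p)=\{\alpha\mid\exists p'.\,p\overset{\alpha}{\Rightarrow}p',\ I(p')=\emptyset\}$. $p\sqsubseteq_T q$ iff $T(p)\subseteq T(q)$; $p\sqsubseteq_{CT}q$ iff $T(p)\subseteq T(q)$ and $CT(p)\subseteq CT(q)$. Derivability $E\vdash t\preceq u$ uses reflexivity, transitivity, closure under prefixing and $+$, and closed substitution instances of axioms (conditional axioms only under closed substitutions satisfying the condition); $t\simeq u$ abbreviates both inequations. $E$ axiomatizes $\sqsubseteq$ if for all closed $p,q$: $E\vdash p\preceq q$ iff $p\sqsubseteq q$. Axioms: $(B_1)$ $x+y\simeq y+x$; $(B_2)$ $(x+y)+z\simeq x+(y+z)$; $(B_3)$ $x+x\simeq x$; $(B_4)$ $x+\mathbf{0}\simeq x$; $(S)$ $x\preceq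 x+y$; $(CS)$ $(I(x)=\emptyset \iff I(y)=\emptyset)\Rightarrow x\preceq x+y$; $(ND^F)$ $a(x+y)\preceq ax+a(y+w)$ for every $a\in\mathit{Act}$. -}

module Defs where

open import Data.Empty using (⊥)
open import Data.Product using (Σ; ∃; _×_; _,_)
open import Data.List using (List; []; _∷_)
open import Relation.Nullary using (¬_)
open import Function.Bundles using (_⇔_)

data Term (Act : Set) (V : Set) : Set where
  𝟎   : Term Act V
  _·_ : Act → Term Act V → Term Act V
  _⊕_ : Term Act V → Term Act V → Term Act V
  var : V → Term Act V

infixr 7 _·_
infixl 6 _⊕_

Proc : Set → Set
Proc Act = Term Act ⊥

_[_] : {Act V : Set} → Term Act V → (V → Proc Act) → Proc Act
𝟎 [ σ ] = 𝟎
(a · t) [ σ ] = a · (t [ σ ])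
(t ⊕ u) [ σ ] = (t [ σ ]) ⊕ (u [ σ ])
var v [ σ ] = σ v

data _─_⟶_ {Act : Set} : Proc Act → Act → Proc Act → Set where
  pref : ∀ a p → (a · p) ─ a ⟶ p
  sumL : ∀ {p a p'} q → p ─ a ⟶ p' → (p ⊕ q) ─ a ⟶ p'
  sumR : ∀ {p a p'} q → p ─ a ⟶ p' → (q ⊕ p) ─ a ⟶ p'

data _═_⇒_ {Act : Set} : Proc Act → List Act → Proc Act → Set where
  done : ∀ p → p ═ [] ⇒ p
  step : ∀ {p a p' α q} → p ─ a ⟶ p' → p' ═ α ⇒ q → p ═ (a ∷ α) ⇒ q

InitEmpty : {Act : Set} → Proc Act → Set
InitEmpty {Act} p = ∀ (a : Act) (p' : Proc Act) → ¬ (p ─ a ⟶ p')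

Trace : {Act : Set} → Proc Act → List Act → Set
Trace p α = ∃ λ p' → p ═ α ⇒ p'

CTrace : {Act : Set} → Proc Act → List Act → Set
CTrace p α = ∃ λ p' → (p ═ α ⇒ p') × InitEmpty p'

_⊑T_ : {Act : Set} → Proc Act → Proc Act → Set
p ⊑T q = ∀ α → Trace p α → Trace q α

_⊑CT_ : {Act : Set} → Proc Act → Proc Act → Set
p ⊑CT q = (∀ α → Trace p α → Trace q α) × (∀ α → CTrace p α → CTrace q α)

-- A (possibly conditional) inequation t ≼ u, with a condition on closed substitutions
record Axiom (Act : Set) : Set₁ where
  field
    Var  : Set
    lhs  : Term Act Var
    rhs  : Term Act Var
    cond : (Var → Proc Act) → Set

record AxSet (Act : Set) : Set₁ where
  field
    Idx : Set
    ax  : Idx → Axiom Act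

data _⊢_≼_ {Act : Set} (E : AxSet Act) : Proc Act → Proc Act → Set where
  ≼-refl  : ∀ p → E ⊢ p ≼ p
  ≼-trans : ∀ {p q r} → E ⊢ p ≼ q → E ⊢ q ≼ r → E ⊢ p ≼ r
  ≼-pre   : ∀ a {p q} → E ⊢ p ≼ q → E ⊢ (a · p) ≼ (a · q)
  ≼-sum   : ∀ {p p' q q'} → E ⊢ p ≼ p' → E ⊢ q ≼ q' → E ⊢ (p ⊕ q) ≼ (p' ⊕ q')
  ≼-ax    : (i : AxSet.Idx E) (σ : Axiom.Var (AxSet.ax E i) → Proc Act) →
            Axiom.cond (AxSet.ax E i) σ →
            E ⊢ (Axiom.lhs (AxSet.ax E i) [ σ ]) ≼ (Axiom.rhs (AxSet.ax E i) [ σ ])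

data V4 : Set where
  x y z w : V4

record ⊤₀ : Set where
  constructor tt

uncond : {Act : Set} → Term Act V4 → Term Act V4 → Axiom Act
uncond t u = record { Var = V4 ; lhs = t ; rhs = u ; cond = λ _ → ⊤₀ }

-- t ≃ u is the pair of inequations t ≼ u and u ≼ t
data Dir : Set where
  ≤dir ≥dir : Dir

eqn : {Act : Set} → Dir → Term Act V4 → Term Act V4 → Axiom Act
eqn ≤dir t u = uncond t u
eqn ≥dir t u = uncond u t

B1 B2 B3 B4 : {Act : Set} → Dir → Axiom Act
B1 d = eqn d (var x ⊕ var y) (var y ⊕ var x)
B2 d = eqn d ((var x ⊕ var y) ⊕ var z) (var x ⊕ (var y ⊕ var z))
B3 d = eqn d (var x ⊕ var x) (var x)
B4 d = eqn d (var x ⊕ 𝟎) (var x)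

S-ax : {Act : Set} → Axiom Act
S-ax = uncond (var x) (var x ⊕ var y)

CS-ax : {Act : Set} → Axiom Act
CS-ax {Act} = record
  { Var = V4
  ; lhs = var x
  ; rhs = var x ⊕ var y
  ; cond = λ σ → InitEmpty (σ x) ⇔ InitEmpty (σ y)
  }

NDF-ax : {Act : Set} → Act → Axiom Act
NDF-ax a = uncond (a · (var x ⊕ var y)) ((a · var x) ⊕ (a · (var y ⊕ var w)))

data IdxT (Act : Set) : Set where
  b1 b2 b3 b4 : Dir → IdxT Act
  s   : IdxT Act
  ndf : Act → IdxT Act

data IdxCT (Act : Set) : Set where
  b1 b2 b3 b4 : Dir → IdxCT Act
  cs  : IdxCT Act
  ndf : Act → IdxCT Act

E-T : (Act : Set) → AxSet Act
E-T Act = record { Idx = IdxT Act ; ax = f }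
  where
  f : IdxT Act → Axiom Act
  f (b1 d) = B1 d
  f (b2 d) = B2 d
  f (b3 d) = B3 d
  f (b4 d) = B4 d
  f s = S-ax
  f (ndf a) = NDF-ax a

E-CT : (Act : Set) → AxSet Act
E-CT Act = record { Idx = IdxCT Act ; ax = f }
  where
  f : IdxCT Act → Axiom Act
  f (b1 d) = B1 d
  f (b2 d) = B2 d
  f (b3 d) = B3 d
  f (b4 d) = B4 d
  f cs = CS-ax
  f (ndf a) = NDF-ax a

Axiomatizes : {Act : Set} → AxSet Act → (Proc Act → Proc Act → Set) → Set
Axiomatizes {Act} E _⊑_ = ∀ (p q : Proc Act) → (E ⊢ p ≼ q) ⇔ (p ⊑ q)

-- Soundness: both preorders are precongruences; the two sides of an instance of B1–B4 have
-- literally the same transitions, (S) and (CS) only add transitions (CS only when this keeps a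
-- stuck process stuck), and (ND^F) only enlarges the (completed) traces after the first a.
-- Completeness: B1–B4 and (ND^F) with w := 𝟎 push every process below the sum of the chains
-- a₁·…·aₙ·𝟎 of its completed traces. A run q ═ α ⇒ q' gives chain α ≼ q: each transition
-- q ─a⟶ q' makes a·q' a summand of q, and a summand that can move is below the whole sum by
-- (S), resp. by (CS) once a stuck remainder is traded for 𝟎. The last step, 𝟎 ≼ q', is
-- (S) for traces and needs q' stuck, i.e. α ∈ CT(q), for completed traces.
module Submission where

open import Defs
open import Data.Empty using (⊥-elim)
open import Data.List using (List; []; _∷_; _++_; map)
open import Data.List.Properties using (++-conicalˡ; ++-conicalʳ)
open import Data.List.Relation.Unary.All as All using (All; []; _∷_)
open import Data.List.Relation.Unary.All.Properties using (++⁺; map⁺)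
open import Data.Product using (_×_; _,_; proj₁; proj₂; ∃₂)
open import Data.Sum using (_⊎_; inj₁; inj₂; [_,_])
open import Function using (_∘_)
open import Function.Bundles using (mk⇔; Equivalence)
open import Relation.Nullary using (¬_)
open import Relation.Binary.PropositionalEquality using (_≡_; refl)

module _ {Act : Set} where

  private variable
    p q r u p' q' : Proc Act
    a : Act
    α : List Act
    E : AxSet Act
    R : Proc Act → Proc Act → Set

  CanStep : Proc Act → Set
  CanStep p = ∃₂ λ a p' → p ─ a ⟶ p'

  ·-¬InitEmpty : ¬ InitEmpty (a · p)
  ·-¬InitEmpty {a} {p} d = d a p (pref a p)

  infix 4 _⟶⊆_ _⟶≈_

  _⟶⊆_ : Proc Act → Proc Act → Set
  p ⟶⊆ q = ∀ {a r} → p ─ a ⟶ r → q ─ a ⟶ r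

  _⟶≈_ : Proc Act → Proc Act → Set
  p ⟶≈ q = p ⟶⊆ q × q ⟶⊆ p

  ⟶≈-sym : p ⟶≈ q → q ⟶≈ p
  ⟶≈-sym (f , g) = g , f

  InitEmpty-anti : q ⟶⊆ p → InitEmpty p → InitEmpty q
  InitEmpty-anti q⊆p dp a r st = dp a r (q⊆p st)

  ⊕-InitEmpty : InitEmpty p → InitEmpty q → InitEmpty (p ⊕ q)
  ⊕-InitEmpty dp dq a r (sumL _ st) = dp a r st
  ⊕-InitEmpty dp dq a r (sumR _ st) = dq a r st

  InitEmpty-or-CanStep : ∀ p → InitEmpty p ⊎ CanStep p
  InitEmpty-or-CanStep 𝟎 = inj₁ λ _ _ ()
  InitEmpty-or-CanStep (a · p) = inj₂ (a , p , pref a p)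
  InitEmpty-or-CanStep (p ⊕ q) with InitEmpty-or-CanStep p | InitEmpty-or-CanStep q
  ... | inj₂ (a , p' , st) | _ = inj₂ (a , p' , sumL q st)
  ... | inj₁ _ | inj₂ (a , q' , st) = inj₂ (a , q' , sumR p st)
  ... | inj₁ dp | inj₁ dq = inj₁ (⊕-InitEmpty dp dq)

  ⊕-InitEmptyˡ : InitEmpty (p ⊕ q) → InitEmpty p
  ⊕-InitEmptyˡ {q = q} = InitEmpty-anti (sumL q)

  ⊕-InitEmptyʳ : InitEmpty (p ⊕ q) → InitEmpty q
  ⊕-InitEmptyʳ {p = p} = InitEmpty-anti (sumR p)

  ⊕-comm-⟶⊆ : p ⊕ q ⟶⊆ q ⊕ p
  ⊕-comm-⟶⊆ (sumL _ st) = sumR _ st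
  ⊕-comm-⟶⊆ (sumR _ st) = sumL _ st

  ⊕-assoc-⟶⊆ : (p ⊕ q) ⊕ r ⟶⊆ p ⊕ (q ⊕ r)
  ⊕-assoc-⟶⊆ (sumL _ (sumL _ st)) = sumL _ st
  ⊕-assoc-⟶⊆ (sumL _ (sumR _ st)) = sumR _ (sumL _ st)
  ⊕-assoc-⟶⊆ (sumR _ st) = sumR _ (sumR _ st)

  ⊕-assoc⁻-⟶⊆ : p ⊕ (q ⊕ r) ⟶⊆ (p ⊕ q) ⊕ r
  ⊕-assoc⁻-⟶⊆ (sumL _ st) = sumL _ (sumL _ st)
  ⊕-assoc⁻-⟶⊆ (sumR _ (sumL _ st)) = sumL _ (sumR _ st)
  ⊕-assoc⁻-⟶⊆ (sumR _ (sumR _ st)) = sumR _ st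

  ⊕-idem-⟶⊆ : p ⊕ p ⟶⊆ p
  ⊕-idem-⟶⊆ (sumL _ st) = st
  ⊕-idem-⟶⊆ (sumR _ st) = st

  ⊕-identityʳ-⟶⊆ : p ⊕ 𝟎 ⟶⊆ p
  ⊕-identityʳ-⟶⊆ (sumL _ st) = st

  ⟶⊆-run : p ⟶⊆ q → p ═ a ∷ α ⇒ r → q ═ a ∷ α ⇒ r
  ⟶⊆-run f (step st ρ) = step (f st) ρ

  ⊕-run-split : (p ⊕ q) ═ a ∷ α ⇒ r → p ═ a ∷ α ⇒ r ⊎ q ═ a ∷ α ⇒ r
  ⊕-run-split (step (sumL _ st) ρ) = inj₁ (step st ρ)
  ⊕-run-split (step (sumR _ st) ρ) = inj₂ (step st ρ)

  ·-Trace : Trace p α → Trace (a · p) (a ∷ α)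
  ·-Trace {p} {a = a} (r , ρ) = r , step (pref a p) ρ

  ⟶⊆⇒⊑T : p ⟶⊆ q → p ⊑T q
  ⟶⊆⇒⊑T {q = q} f [] _ = q , done q
  ⟶⊆⇒⊑T f (_ ∷ _) (r , ρ) = r , ⟶⊆-run f ρ

  ⟶≈⇒⊑T : p ⟶≈ q → p ⊑T q
  ⟶≈⇒⊑T (f , _) = ⟶⊆⇒⊑T f

  ⊕-Trace-split : Trace (p ⊕ q) α → Trace p α ⊎ Trace q α
  ⊕-Trace-split {p} (_ , done _) = inj₁ (p , done p)
  ⊕-Trace-split (r , ρ@(step _ _)) with ⊕-run-split ρ
  ... | inj₁ ρ' = inj₁ (r , ρ')
  ... | inj₂ ρ' = inj₂ (r , ρ')

  -- Unlike the empty one, nonempty completed traces survive adding summands.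
  data CTrace⁺ (p : Proc Act) : List Act → Set where
    nonempty : CTrace p (a ∷ α) → CTrace⁺ p (a ∷ α)

  ctrace : CTrace⁺ p α → CTrace p α
  ctrace (nonempty c) = c

  ·-CTrace⁺ : CTrace p α → CTrace⁺ (a · p) (a ∷ α)
  ·-CTrace⁺ {p} {a = a} (r , ρ , d) = nonempty (r , step (pref a p) ρ , d)

  ⟶⊆-CTrace⁺ : p ⟶⊆ q → CTrace⁺ p α → CTrace⁺ q α
  ⟶⊆-CTrace⁺ f (nonempty (r , ρ , d)) = nonempty (r , ⟶⊆-run f ρ , d)

  ⊕-CTrace⁺-split : CTrace⁺ (p ⊕ q) α → CTrace⁺ p α ⊎ CTrace⁺ q α
  ⊕-CTrace⁺-split (nonempty (r , ρ , d)) with ⊕-run-split ρ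
  ... | inj₁ ρ' = inj₁ (nonempty (r , ρ' , d))
  ... | inj₂ ρ' = inj₂ (nonempty (r , ρ' , d))

  ⊑CT-from-CTrace⁺ : p ⊑T q → (InitEmpty p → InitEmpty q) →
                     (∀ {α} → CTrace⁺ p α → CTrace⁺ q α) → p ⊑CT q
  ⊑CT-from-CTrace⁺ p⊑q _ _ .proj₁ = p⊑q
  ⊑CT-from-CTrace⁺ {q = q} _ dead⇒dead _ .proj₂ [] (_ , done _ , d) = q , done q , dead⇒dead d
  ⊑CT-from-CTrace⁺ _ _ f .proj₂ (_ ∷ _) c = ctrace (f (nonempty c))

  ⊑CT-InitEmpty : p ⊑CT q → InitEmpty p → InitEmpty q
  ⊑CT-InitEmpty {p} (_ , f) d with f [] (p , done p , d)
  ... | _ , done _ , d' = d'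

  ⟶⊆⇒⊑CT : p ⟶⊆ q → (InitEmpty p → InitEmpty q) → p ⊑CT q
  ⟶⊆⇒⊑CT f dead⇒dead = ⊑CT-from-CTrace⁺ (⟶⊆⇒⊑T f) dead⇒dead (⟶⊆-CTrace⁺ f)

  ⟶≈⇒⊑CT : p ⟶≈ q → p ⊑CT q
  ⟶≈⇒⊑CT (f , g) = ⟶⊆⇒⊑CT f (InitEmpty-anti g)

  record Precongruence (_⊑_ : Proc Act → Proc Act → Set) : Set where
    field
      ⊑-refl  : ∀ {p} → p ⊑ p
      ⊑-trans : ∀ {p q r} → p ⊑ q → q ⊑ r → p ⊑ r
      ·-mono  : ∀ {a p q} → p ⊑ q → (a · p) ⊑ (a · q)
      ⊕-mono  : ∀ {p p' q q'} → p ⊑ p' → q ⊑ q' → (p ⊕ q) ⊑ (p' ⊕ q')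

  AxiomSound : (Proc Act → Proc Act → Set) → Axiom Act → Set
  AxiomSound _⊑_ A = ∀ σ → Axiom.cond A σ → (Axiom.lhs A [ σ ]) ⊑ (Axiom.rhs A [ σ ])

  sound : Precongruence R → (∀ i → AxiomSound R (AxSet.ax E i)) → E ⊢ p ≼ q → R p q
  sound {R = R} {E = E} pc ax-sound = go
    where
    open Precongruence pc
    go : E ⊢ p ≼ q → R p q
    go (≼-refl p) = ⊑-refl
    go (≼-trans d e) = ⊑-trans (go d) (go e)
    go (≼-pre a d) = ·-mono (go d)
    go (≼-sum d e) = ⊕-mono (go d) (go e)
    go (≼-ax i σ c) = ax-sound i σ c

  eqn-⟶≈ : ∀ {t u} → (∀ σ → (t [ σ ]) ⟶≈ (u [ σ ])) → ∀ d → AxiomSound _⟶≈_ (eqn d t u)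
  eqn-⟶≈ t≈u ≤dir σ _ = t≈u σ
  eqn-⟶≈ t≈u ≥dir σ _ = ⟶≈-sym (t≈u σ)

  B1-⟶≈ : ∀ d → AxiomSound _⟶≈_ (B1 {Act} d)
  B1-⟶≈ = eqn-⟶≈ λ _ → ⊕-comm-⟶⊆ , ⊕-comm-⟶⊆

  B2-⟶≈ : ∀ d → AxiomSound _⟶≈_ (B2 {Act} d)
  B2-⟶≈ = eqn-⟶≈ λ _ → ⊕-assoc-⟶⊆ , ⊕-assoc⁻-⟶⊆

  B3-⟶≈ : ∀ d → AxiomSound _⟶≈_ (B3 {Act} d)
  B3-⟶≈ = eqn-⟶≈ λ σ → ⊕-idem-⟶⊆ , sumL (σ x)

  B4-⟶≈ : ∀ d → AxiomSound _⟶≈_ (B4 {Act} d)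
  B4-⟶≈ = eqn-⟶≈ λ _ → ⊕-identityʳ-⟶⊆ , sumL 𝟎

  ⊑T-precongruence : Precongruence _⊑T_
  ⊑T-precongruence = record
    { ⊑-refl  = λ _ τ → τ
    ; ⊑-trans = λ f g α → g α ∘ f α
    ; ·-mono  = ·-mono
    ; ⊕-mono  = λ f g α → [ ⟶⊆⇒⊑T (sumL _) α ∘ f α , ⟶⊆⇒⊑T (sumR _) α ∘ g α ] ∘ ⊕-Trace-split
    }
    where
    ·-mono : p ⊑T q → (a · p) ⊑T (a · q)
    ·-mono _ [] _ = _ , done _
    ·-mono f (_ ∷ α) (r , step (pref _ _) ρ) = ·-Trace (f α (r , ρ))

  ⊑CT-precongruence : Precongruence _⊑CT_
  ⊑CT-precongruence = record
    { ⊑-refl  = (λ _ τ → τ) , (λ _ c → c)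
    ; ⊑-trans = λ (f , f') (g , g') → (λ α → g α ∘ f α) , (λ α → g' α ∘ f' α)
    ; ·-mono  = ·-mono
    ; ⊕-mono  = ⊕-mono
    }
    where
    open Precongruence ⊑T-precongruence using () renaming (·-mono to ·-monoT; ⊕-mono to ⊕-monoT)

    ·-mono : p ⊑CT q → (a · p) ⊑CT (a · q)
    ·-mono (f , g) = ⊑CT-from-CTrace⁺ (·-monoT f) (⊥-elim ∘ ·-¬InitEmpty)
      λ { (nonempty (r , step (pref _ _) ρ , d)) → ·-CTrace⁺ (g _ (r , ρ , d)) }

    ⊕-mono : p ⊑CT p' → q ⊑CT q' → (p ⊕ q) ⊑CT (p' ⊕ q')
    ⊕-mono p⊑p' q⊑q' = ⊑CT-from-CTrace⁺ (⊕-monoT (proj₁ p⊑p') (proj₁ q⊑q'))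
      (λ d → ⊕-InitEmpty (⊑CT-InitEmpty p⊑p' (⊕-InitEmptyˡ d)) (⊑CT-InitEmpty q⊑q' (⊕-InitEmptyʳ d)))
      ([ ⟶⊆-CTrace⁺ (sumL _) ∘ ⊑CT-CTrace⁺ p⊑p' , ⟶⊆-CTrace⁺ (sumR _) ∘ ⊑CT-CTrace⁺ q⊑q' ] ∘ ⊕-CTrace⁺-split)
      where
      ⊑CT-CTrace⁺ : p ⊑CT q → CTrace⁺ p α → CTrace⁺ q α
      ⊑CT-CTrace⁺ (_ , g) (nonempty c) = nonempty (g _ c)

  NDF-⊑T : (a · (p ⊕ q)) ⊑T ((a · p) ⊕ (a · (q ⊕ u)))
  NDF-⊑T [] _ = _ , done _
  NDF-⊑T (_ ∷ α) (r , step (pref _ _) ρ) with ⊕-Trace-split (r , ρ)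
  ... | inj₁ τ = ⟶⊆⇒⊑T (sumL _) _ (·-Trace τ)
  ... | inj₂ τ = ⟶⊆⇒⊑T (sumR _) _ (·-Trace (⟶⊆⇒⊑T (sumL _) α τ))

  NDF-⊑CT : (a · (p ⊕ q)) ⊑CT ((a · p) ⊕ (a · (q ⊕ u)))
  NDF-⊑CT = ⊑CT-from-CTrace⁺ NDF-⊑T (⊥-elim ∘ ·-¬InitEmpty) ctraces⁺
    where
    ctraces⁺ : CTrace⁺ (a · (p ⊕ q)) α → CTrace⁺ ((a · p) ⊕ (a · (q ⊕ u))) α
    ctraces⁺ {p = p} (nonempty (_ , step (pref _ _) (done _) , d)) =
      ⟶⊆-CTrace⁺ (sumL _) (·-CTrace⁺ (p , done p , ⊕-InitEmptyˡ d))
    ctraces⁺ (nonempty (r , step (pref _ _) ρ@(step _ _) , d)) =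
      [ ⟶⊆-CTrace⁺ (sumL _) ∘ ·-CTrace⁺ ∘ ctrace
      , ⟶⊆-CTrace⁺ (sumR _) ∘ ·-CTrace⁺ ∘ ctrace ∘ ⟶⊆-CTrace⁺ (sumL _)
      ] (⊕-CTrace⁺-split (nonempty (r , ρ , d)))

  E-T-sound : ∀ i → AxiomSound _⊑T_ (AxSet.ax (E-T Act) i)
  E-T-sound (b1 d) σ c = ⟶≈⇒⊑T (B1-⟶≈ d σ c)
  E-T-sound (b2 d) σ c = ⟶≈⇒⊑T (B2-⟶≈ d σ c)
  E-T-sound (b3 d) σ c = ⟶≈⇒⊑T (B3-⟶≈ d σ c)
  E-T-sound (b4 d) σ c = ⟶≈⇒⊑T (B4-⟶≈ d σ c)
  E-T-sound s σ _ = ⟶⊆⇒⊑T (sumL (σ y))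
  E-T-sound (ndf a) σ _ = NDF-⊑T

  E-CT-sound : ∀ i → AxiomSound _⊑CT_ (AxSet.ax (E-CT Act) i)
  E-CT-sound (b1 d) σ c = ⟶≈⇒⊑CT (B1-⟶≈ d σ c)
  E-CT-sound (b2 d) σ c = ⟶≈⇒⊑CT (B2-⟶≈ d σ c)
  E-CT-sound (b3 d) σ c = ⟶≈⇒⊑CT (B3-⟶≈ d σ c)
  E-CT-sound (b4 d) σ c = ⟶≈⇒⊑CT (B4-⟶≈ d σ c)
  E-CT-sound cs σ dead⇔dead = ⟶⊆⇒⊑CT (sumL (σ y)) λ d → ⊕-InitEmpty d (Equivalence.to dead⇔dead d)
  E-CT-sound (ndf a) σ _ = NDF-⊑CT

  chain : List Act → Proc Act
  chain [] = 𝟎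
  chain (a ∷ α) = a · chain α

  ⅀ : List (List Act) → Proc Act
  ⅀ [] = 𝟎
  ⅀ (α ∷ L) = chain α ⊕ ⅀ L

  prefixAll : Act → List (List Act) → List (List Act)
  prefixAll a [] = (a ∷ []) ∷ []
  prefixAll a L@(_ ∷ _) = map (a ∷_) L

  -- The completed traces of p, read off its syntax; a stuck p gets none rather than [].
  chains : Proc Act → List (List Act)
  chains 𝟎 = []
  chains (a · p) = prefixAll a (chains p)
  chains (p ⊕ q) = chains p ++ chains q

  chains-[]⇒InitEmpty : ∀ p → chains p ≡ [] → InitEmpty p
  chains-[]⇒InitEmpty 𝟎 _ _ _ ()
  chains-[]⇒InitEmpty (a · p) eq with chains p
  chains-[]⇒InitEmpty (a · p) () | []
  chains-[]⇒InitEmpty (a · p) () | _ ∷ _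
  chains-[]⇒InitEmpty (p ⊕ q) eq = ⊕-InitEmpty
    (chains-[]⇒InitEmpty p (++-conicalˡ (chains p) (chains q) eq))
    (chains-[]⇒InitEmpty q (++-conicalʳ (chains p) (chains q) eq))

  chains-CTrace⁺ : ∀ p → All (CTrace⁺ p) (chains p)
  chains-CTrace⁺ 𝟎 = []
  chains-CTrace⁺ (a · p) = prefixAll-CTrace⁺ (chains p) (chains-[]⇒InitEmpty p) (chains-CTrace⁺ p)
    where
    prefixAll-CTrace⁺ : ∀ L → (L ≡ [] → InitEmpty p) → All (CTrace⁺ p) L → All (CTrace⁺ (a · p)) (prefixAll a L)
    prefixAll-CTrace⁺ [] stuck [] = ·-CTrace⁺ (p , done p , stuck refl) ∷ []
    prefixAll-CTrace⁺ (_ ∷ _) _ cts = map⁺ (All.map (·-CTrace⁺ ∘ ctrace) cts)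
  chains-CTrace⁺ (p ⊕ q) =
    ++⁺ (All.map (⟶⊆-CTrace⁺ (sumL q)) (chains-CTrace⁺ p)) (All.map (⟶⊆-CTrace⁺ (sumR p)) (chains-CTrace⁺ q))

  record CoreLaws (E : AxSet Act) : Set where
    field
      ⊕-comm       : ∀ p q → E ⊢ p ⊕ q ≼ (q ⊕ p)
      ⊕-assoc      : ∀ p q r → E ⊢ (p ⊕ q) ⊕ r ≼ (p ⊕ (q ⊕ r))
      ⊕-idem       : ∀ p → E ⊢ p ⊕ p ≼ p
      ⊕-identityʳ  : ∀ p → E ⊢ p ⊕ 𝟎 ≼ p
      ⊕-identityʳ⁻ : ∀ p → E ⊢ p ≼ (p ⊕ 𝟎)
      ·-⊕-NDF      : ∀ a p q r → E ⊢ a · (p ⊕ q) ≼ (a · p ⊕ a · (q ⊕ r))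

  module Normalisation {E : AxSet Act} (laws : CoreLaws E) where
    open CoreLaws laws

    ·-distrib-⅀ : ∀ a α L → E ⊢ a · (chain α ⊕ ⅀ L) ≼ ⅀ (map (a ∷_) (α ∷ L))
    ·-distrib-⅀ a α [] = ≼-trans (≼-pre a (⊕-identityʳ _)) (⊕-identityʳ⁻ _)
    ·-distrib-⅀ a α (β ∷ L) = ≼-trans (·-⊕-NDF a (chain α) (⅀ (β ∷ L)) 𝟎)
      (≼-sum (≼-refl _) (≼-trans (≼-pre a (⊕-identityʳ _)) (·-distrib-⅀ a β L)))

    ·-⅀ : ∀ a L → E ⊢ p ≼ ⅀ L → E ⊢ a · p ≼ ⅀ (prefixAll a L)
    ·-⅀ a [] p≼ = ≼-trans (≼-pre a p≼) (⊕-identityʳ⁻ _)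
    ·-⅀ a (α ∷ L) p≼ = ≼-trans (≼-pre a p≼) (·-distrib-⅀ a α L)

    ⅀-++ : ∀ L M → E ⊢ ⅀ L ⊕ ⅀ M ≼ ⅀ (L ++ M)
    ⅀-++ [] M = ≼-trans (⊕-comm 𝟎 (⅀ M)) (⊕-identityʳ _)
    ⅀-++ (α ∷ L) M = ≼-trans (⊕-assoc _ _ _) (≼-sum (≼-refl _) (⅀-++ L M))

    normalise : ∀ p → E ⊢ p ≼ ⅀ (chains p)
    normalise 𝟎 = ≼-refl 𝟎
    normalise (a · p) = ·-⅀ a (chains p) (normalise p)
    normalise (p ⊕ q) = ≼-trans (≼-sum (normalise p) (normalise q)) (⅀-++ (chains p) (chains q))

    ⅀-least : ∀ L → All (λ α → E ⊢ chain α ≼ q) L → (L ≡ [] → E ⊢ 𝟎 ≼ q) → E ⊢ ⅀ L ≼ q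
    ⅀-least [] [] 𝟎≼q = 𝟎≼q refl
    -- Peeling off the last summand avoids 𝟎 ≼ q, which fails for ⊑CT when q can move.
    ⅀-least (α ∷ []) (α≼q ∷ []) _ = ≼-trans (⊕-identityʳ _) α≼q
    ⅀-least (α ∷ L@(_ ∷ _)) (α≼q ∷ L≼q) _ = ≼-trans (≼-sum α≼q (⅀-least L L≼q λ ())) (⊕-idem _)

    ≼-via-chains : ∀ p → All (λ α → E ⊢ chain α ≼ q) (chains p) → (chains p ≡ [] → E ⊢ 𝟎 ≼ q) → E ⊢ p ≼ q
    ≼-via-chains p chains≼q 𝟎≼q = ≼-trans (normalise p) (⅀-least (chains p) chains≼q 𝟎≼q)

    module _ (⊕-weaken : ∀ {p} r → CanStep p → E ⊢ p ≼ (p ⊕ r)) where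

      step-summand : q ─ a ⟶ q' → E ⊢ a · q' ≼ q
      step-summand (pref a p) = ≼-refl _
      step-summand (sumL r st) = ≼-trans (step-summand st) (⊕-weaken r (_ , _ , st))
      step-summand (sumR r st) = ≼-trans (step-summand st) (≼-trans (⊕-weaken r (_ , _ , st)) (⊕-comm _ r))

      run-chain : q ═ α ⇒ q' → E ⊢ 𝟎 ≼ q' → E ⊢ chain α ≼ q
      run-chain (done _) 𝟎≼q' = 𝟎≼q'
      run-chain (step {a = a} st ρ) 𝟎≼q' = ≼-trans (≼-pre a (run-chain ρ 𝟎≼q')) (step-summand st)

  assign : Proc Act → Proc Act → Proc Act → Proc Act → V4 → Proc Act
  assign p _ _ _ x = p
  assign _ q _ _ y = q
  assign _ _ r _ z = r
  assign _ _ _ u w = u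

  E-T-core : CoreLaws (E-T Act)
  E-T-core = record
    { ⊕-comm       = λ p q → ≼-ax (b1 ≤dir) (assign p q 𝟎 𝟎) tt
    ; ⊕-assoc      = λ p q r → ≼-ax (b2 ≤dir) (assign p q r 𝟎) tt
    ; ⊕-idem       = λ p → ≼-ax (b3 ≤dir) (assign p 𝟎 𝟎 𝟎) tt
    ; ⊕-identityʳ  = λ p → ≼-ax (b4 ≤dir) (assign p 𝟎 𝟎 𝟎) tt
    ; ⊕-identityʳ⁻ = λ p → ≼-ax (b4 ≥dir) (assign p 𝟎 𝟎 𝟎) tt
    ; ·-⊕-NDF      = λ a p q r → ≼-ax (ndf a) (assign p q 𝟎 r) tt
    }

  E-CT-core : CoreLaws (E-CT Act)
  E-CT-core = record
    { ⊕-comm       = λ p q → ≼-ax (b1 ≤dir) (assign p q 𝟎 𝟎) tt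
    ; ⊕-assoc      = λ p q r → ≼-ax (b2 ≤dir) (assign p q r 𝟎) tt
    ; ⊕-idem       = λ p → ≼-ax (b3 ≤dir) (assign p 𝟎 𝟎 𝟎) tt
    ; ⊕-identityʳ  = λ p → ≼-ax (b4 ≤dir) (assign p 𝟎 𝟎 𝟎) tt
    ; ⊕-identityʳ⁻ = λ p → ≼-ax (b4 ≥dir) (assign p 𝟎 𝟎 𝟎) tt
    ; ·-⊕-NDF      = λ a p q r → ≼-ax (ndf a) (assign p q 𝟎 r) tt
    }

  module _ where
    open CoreLaws E-T-core
    open Normalisation E-T-core

    S-weaken : ∀ {p} r → E-T Act ⊢ p ≼ (p ⊕ r)
    S-weaken {p} r = ≼-ax s (assign p r 𝟎 𝟎) tt

    𝟎≼ : ∀ q → E-T Act ⊢ 𝟎 ≼ q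
    𝟎≼ q = ≼-trans (S-weaken q) (≼-trans (⊕-comm 𝟎 q) (⊕-identityʳ q))

    ⊑T-complete : ∀ p q → p ⊑T q → E-T Act ⊢ p ≼ q
    ⊑T-complete p q p⊑q = ≼-via-chains p (All.map chain≼q (chains-CTrace⁺ p)) (λ _ → 𝟎≼ q)
      where
      chain≼q : CTrace⁺ p α → E-T Act ⊢ chain α ≼ q
      chain≼q (nonempty (r , ρ , _)) = run-chain (λ r _ → S-weaken r) (proj₂ (p⊑q _ (r , ρ))) (𝟎≼ _)

  module _ where
    open CoreLaws E-CT-core
    open Normalisation E-CT-core

    𝟎≼-stuck : InitEmpty q → E-CT Act ⊢ 𝟎 ≼ q
    𝟎≼-stuck {q} stuck = ≼-trans (≼-ax cs (assign 𝟎 q 𝟎 𝟎) (mk⇔ (λ _ → stuck) (λ _ _ _ ())))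
                                 (≼-trans (⊕-comm 𝟎 q) (⊕-identityʳ q))

    CS-weaken : ∀ {p} r → CanStep p → E-CT Act ⊢ p ≼ (p ⊕ r)
    CS-weaken {p} r (a , p' , st) with InitEmpty-or-CanStep r
    ... | inj₁ stuck = ≼-trans (⊕-identityʳ⁻ p) (≼-sum (≼-refl p) (𝟎≼-stuck stuck))
    ... | inj₂ (b , r' , st') = ≼-ax cs (assign p r 𝟎 𝟎)
            (mk⇔ (λ stuck → ⊥-elim (stuck a p' st)) (λ stuck → ⊥-elim (stuck b r' st')))

    ⊑CT-complete : ∀ p q → p ⊑CT q → E-CT Act ⊢ p ≼ q
    ⊑CT-complete p q p⊑q = ≼-via-chains p (All.map chain≼q (chains-CTrace⁺ p))
      (𝟎≼-stuck ∘ ⊑CT-InitEmpty p⊑q ∘ chains-[]⇒InitEmpty p)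
      where
      chain≼q : CTrace⁺ p α → E-CT Act ⊢ chain α ≼ q
      chain≼q (nonempty c) with proj₂ p⊑q _ c
      ... | _ , ρ , stuck = run-chain CS-weaken ρ (𝟎≼-stuck stuck)

proposition3p8 : (Act : Set) →
    Axiomatizes (E-T Act) _⊑T_ × Axiomatizes (E-CT Act) _⊑CT_
proposition3p8 Act =
  (λ p q → mk⇔ (sound ⊑T-precongruence E-T-sound) (⊑T-complete p q)) ,
  (λ p q → mk⇔ (sound ⊑CT-precongruence E-CT-sound) (⊑CT-complete p q))
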